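{- For each positive integer $k$, let $N_k(x)$ be the number of odd integers $m$ with $1<m\le x$ and $D(m)\le k$. Then \[ \lim_{x\to\infty}\frac{N_1(x)}{x/2}=\frac12,\qquad \lim_{x\to\infty}\frac{N_2(x)}{x/2}=\frac58,\qquad \lim_{x\to\infty}\frac{N_3(x)}{x/2}=\frac34 . \]
   Context: The Syracuse function $S$ on odd positive integers is defined by $S(m)=(3m+1)/2^e$, where $e$ is the largest integer with $2^e\mid 3m+1$; $S^k$ is its $k$th iterate. For an odd integer $m>1$, the dropping time $D(m)$ is the smallest positive integer $k$ with $S^k(m)<m$, and $D(m)=\infty$ if no such $k$ exists. -}

module Defs where

open import Data.Nat using (ℕ; zero; suc; _+_; _*_; _<_; _≤_; _≡ᵇ_; _%_; _/_; NonZero)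
open import Data.Nat.Properties using (_<?_; _≟_)
open import Data.Bool using (Bool; true; false; if_then_else_; _∧_; not)
open import Data.Fin using (Fin; toℕ)
open import Data.Fin.Properties using (any?)
open import Data.Product using (Σ; ∃; _×_; _,_)
open import Data.List using (List; length; filter; upTo)
open import Data.Integer using (ℤ; +_)
open import Data.Rational using (ℚ; 0ℚ; _-_; ∣_∣) renaming (_<_ to _<ℚ_; _/_ to _/ℚ_)
open import Relation.Nullary using (Dec)
open import Relation.Nullary.Decidable using (_×-dec_)
open import Relation.Binary.PropositionalEquality using (_≡_)

-- Divide out all factors of 2, with fuel (fuel = n suffices for n ≥ 1).
halveAll : ℕ → ℕ → ℕ
halveAll zero n = n
halveAll (suc f) n =
  if (not (n ≡ᵇ 0) ∧ (n % 2 ≡ᵇ 0)) then halveAll f (n / 2) else n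

oddPart : ℕ → ℕ
oddPart n = halveAll n n

S : ℕ → ℕ
S m = oddPart (3 * m + 1)

iter : ℕ → ℕ → ℕ
iter zero m = m
iter (suc k) m = S (iter k m)

Odd : ℕ → Set
Odd m = m % 2 ≡ 1

-- D(m) ≤ k : some j with 1 ≤ j ≤ k has S^j(m) < m   (j = suc (toℕ i), i : Fin k)
DropWithin : ℕ → ℕ → Set
DropWithin k m = ∃ λ (i : Fin k) → iter (suc (toℕ i)) m < m

dropWithin? : (k m : ℕ) → Dec (DropWithin k m)
dropWithin? k m = any? (λ i → iter (suc (toℕ i)) m <? m)

Counted : ℕ → ℕ → Set
Counted k m = Odd m × (1 < m × DropWithin k m)

counted? : (k m : ℕ) → Dec (Counted k m)
counted? k m = (m % 2 ≟ 1) ×-dec ((1 <? m) ×-dec dropWithin? k m)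

-- N_k(x) = #{ m odd : 1 < m ≤ x, D(m) ≤ k }   (upTo (suc x) = [0 .. x])
N : ℕ → ℕ → ℕ
N k x = length (filter (counted? k) (upTo (suc x)))

-- N_k(x) / (x/2) = 2 N_k(x) / x as a rational (value at x = 0 is irrelevant)
ratio : ℕ → ℕ → ℚ
ratio k zero = 0ℚ
ratio k (suc n) = (+ (2 * N k (suc n))) /ℚ (suc n)

Tendsto : (ℕ → ℚ) → ℚ → Set
Tendsto f c = (ε : ℚ) → 0ℚ <ℚ ε → Σ ℕ λ X → (x : ℕ) → X ≤ x → ∣ f x - c ∣ <ℚ ε

-- If m = 32 q + r, then as long as the trajectory of m stays above m, the parities met in its
-- first three Syracuse steps, and so the powers of 2 divided out, depend only on r: each of these
-- iterates is an affine function of q, or is bounded by one at the step where it drops below m.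
-- Comparing coefficients therefore decides D(m) ≤ k for k ≤ 3 uniformly in q, the counted set
-- is 32-periodic on m ≥ 2, and one period contains 8, 10 and 12 counted numbers for k = 1, 2, 3
-- (the residues 1 mod 4, then also 3 and 19, then also 11 and 23). Hence N_k(x) = c_k x / 32 + O(1).

module Submission where

open import Defs
open import Data.Bool using (true; false; not; _∧_)
open import Data.Bool.Properties using (∧-zeroʳ)
open import Data.Fin using (fromℕ<)
open import Data.Fin.Properties using (toℕ<n; toℕ-fromℕ<)
open import Data.Integer using (+_)
import Data.Integer as ℤ
import Data.Integer.Properties as ℤ
open import Data.List using ([_]; _++_; length; filter; upTo)
open import Data.List.Properties using (upTo-∷ʳ; filter-++; length-++; length-filter; length-upTo)
open import Data.Nat hiding (_/_)
import Data.Nat as ℕ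
open import Data.Nat.DivMod using (m≡m%n+[m/n]*n; m%n<n; m/n≤m; m*n%n≡0; m*n/n≡m; [m+kn]%n≡m%n)
open import Data.Nat.Properties
open import Algebra.Properties.CommutativeSemigroup +-commutativeSemigroup using (xy∙z≈xz∙y; x∙yz≈y∙xz)
open import Data.Nat.Tactic.RingSolver using (solve-∀)
open import Data.Product using (∃-syntax; _×_; _,_; proj₁; proj₂; map₁)
open import Data.Rational using (_/_)
import Data.Rational as ℚ
open import Data.Rational.Properties using (toℚᵘ-cancel-<; toℚᵘ-homo-∣-∣; toℚᵘ-homo-+; toℚᵘ-homo‿-; toℚᵘ-fromℚᵘ)
import Data.Rational.Unnormalised as ℚᵘ
import Data.Rational.Unnormalised.Properties as ℚᵘ
open import Data.Sum using (inj₁; inj₂)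
open import Function using (_∘_; _⇔_; mk⇔; Equivalence)
open import Function.Construct.Composition using (_⇔-∘_)
open import Function.Construct.Symmetry using (⇔-sym)
open import Relation.Binary.PropositionalEquality hiding ([_])
open import Relation.Nullary using (Dec; does)
open import Relation.Nullary.Decidable using (_×-dec_; _→-dec_; toWitness; does-⇔)
open import Relation.Unary using (Pred; Decidable)

-- Odd parts

n<2^n : ∀ n → n < 2 ^ n
n<2^n zero = s≤s z≤n
n<2^n (suc n) = begin-strict
  suc n          ≤⟨ n<2^n n ⟩
  2 ^ n          <⟨ m<m+n (2 ^ n) (m^n>0 2 n) ⟩
  2 ^ n + 2 ^ n  ≡⟨ cong (_+_ (2 ^ n)) (sym (+-identityʳ (2 ^ n))) ⟩
  2 ^ suc n      ∎
  where open ≤-Reasoning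

odd⇒nonZero : ∀ {n} → Odd n → NonZero n
odd⇒nonZero {suc n} _ = _

2*m+n-odd : ∀ m {n} → Odd n → Odd (2 * m + n)
2*m+n-odd m {n} n-odd = begin
  (2 * m + n) % 2  ≡⟨ cong (_% 2) (trans (+-comm (2 * m) n) (cong (_+_ n) (*-comm 2 m))) ⟩
  (n + m * 2) % 2  ≡⟨ [m+kn]%n≡m%n n m 2 ⟩
  n % 2            ≡⟨ n-odd ⟩
  1                ∎
  where open ≡-Reasoning

halveAll-≤ : ∀ f n → halveAll f n ≤ n
halveAll-≤ zero n = ≤-refl
halveAll-≤ (suc f) n with not (n ≡ᵇ 0) ∧ (n % 2 ≡ᵇ 0)
... | true  = ≤-trans (halveAll-≤ f (n ℕ./ 2)) (m/n≤m n 2)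
... | false = ≤-refl

halveAll-odd : ∀ f {n} → Odd n → halveAll f n ≡ n
halveAll-odd zero _ = refl
halveAll-odd (suc f) {n} n-odd rewrite n-odd | ∧-zeroʳ (not (n ≡ᵇ 0)) = refl

halveAll-2* : ∀ f n .{{_ : NonZero n}} → halveAll (suc f) (2 * n) ≡ halveAll f n
halveAll-2* f n@(suc _)
  rewrite trans (cong (_% 2) (*-comm 2 n)) (m*n%n≡0 n 2)
        | trans (cong (ℕ._/ 2) (*-comm 2 n)) (m*n/n≡m n 2) = refl

halveAll-2^* : ∀ e f n .{{_ : NonZero n}} → halveAll (e + f) (2 ^ e * n) ≡ halveAll f n
halveAll-2^* zero f n rewrite +-identityʳ n = refl
halveAll-2^* (suc e) f n = begin
  halveAll (suc e + f) (2 * 2 ^ e * n)    ≡⟨ cong (halveAll (suc e + f)) (*-assoc 2 (2 ^ e) n) ⟩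
  halveAll (suc e + f) (2 * (2 ^ e * n))  ≡⟨ halveAll-2* (e + f) (2 ^ e * n) {{m*n≢0 (2 ^ e) n {{m^n≢0 2 e}}}} ⟩
  halveAll (e + f) (2 ^ e * n)            ≡⟨ halveAll-2^* e f n ⟩
  halveAll f n                            ∎
  where open ≡-Reasoning

-- oddPart uses its argument as fuel, which is more than the e halvings needed.
oddPart-2^* : ∀ e n .{{_ : NonZero n}} → oddPart (2 ^ e * n) ≡ halveAll (2 ^ e * n ∸ e) n
oddPart-2^* e n = trans (cong (λ f → halveAll f (2 ^ e * n)) (sym (m+[n∸m]≡n e≤2^e*n)))
                        (halveAll-2^* e (2 ^ e * n ∸ e) n)
  where
    e≤2^e*n : e ≤ 2 ^ e * n
    e≤2^e*n = ≤-trans (<⇒≤ (n<2^n e)) (m≤m*n (2 ^ e) n)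

oddPart-2^*-≤ : ∀ e n → oddPart (2 ^ e * n) ≤ n
oddPart-2^*-≤ e zero rewrite *-zeroʳ (2 ^ e) = z≤n
oddPart-2^*-≤ e n@(suc _) = ≤-trans (≤-reflexive (oddPart-2^* e n)) (halveAll-≤ (2 ^ e * n ∸ e) n)

oddPart-2^*-odd : ∀ e {n} → Odd n → oddPart (2 ^ e * n) ≡ n
oddPart-2^*-odd e {n} n-odd = trans (oddPart-2^* e n {{odd⇒nonZero n-odd}}) (halveAll-odd (2 ^ e * n ∸ e) n-odd)

-- Syracuse steps on affine families

record Affine : Set where
  constructor affine
  field
    power factor offset : ℕ

open Affine using (offset)

coefficient : Affine → ℕ
coefficient (affine a t _) = 2 ^ a * t

⟦_⟧ : Affine → ℕ → ℕ
⟦ x ⟧ q = coefficient x * q + offset x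

-- Divides at most a factors 2 out of n, as many as a coefficient 2 ^ a can absorb; splitTwos a 0 = (a , 0).
splitTwos : ℕ → ℕ → ℕ × ℕ
splitTwos zero n = 0 , n
splitTwos (suc a) n with n % 2
... | zero  = map₁ suc (splitTwos a (n ℕ./ 2))
... | suc _ = 0 , n

splitTwos-≤ : ∀ a n → proj₁ (splitTwos a n) ≤ a
splitTwos-≤ zero n = z≤n
splitTwos-≤ (suc a) n with n % 2
... | zero  = s≤s (splitTwos-≤ a (n ℕ./ 2))
... | suc _ = z≤n

splitTwos-≡ : ∀ a n → n ≡ 2 ^ proj₁ (splitTwos a n) * proj₂ (splitTwos a n)
splitTwos-≡ zero n = sym (*-identityˡ n)
splitTwos-≡ (suc a) n with n % 2 in n-even
... | zero  = begin
  n                      ≡⟨ m≡m%n+[m/n]*n n 2 ⟩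
  n % 2 + n ℕ./ 2 * 2    ≡⟨ cong (_+ n ℕ./ 2 * 2) n-even ⟩
  n ℕ./ 2 * 2            ≡⟨ *-comm (n ℕ./ 2) 2 ⟩
  2 * (n ℕ./ 2)          ≡⟨ cong (2 *_) (splitTwos-≡ a (n ℕ./ 2)) ⟩
  2 * (2 ^ e * s)        ≡⟨ sym (*-assoc 2 (2 ^ e) s) ⟩
  2 ^ suc e * s          ∎
  where
    open ≡-Reasoning
    e = proj₁ (splitTwos a (n ℕ./ 2))
    s = proj₂ (splitTwos a (n ℕ./ 2))
... | suc _ = sym (*-identityˡ n)

stepSplit : Affine → ℕ × ℕ
stepSplit (affine a _ b) = splitTwos a (3 * b + 1)

Sₐ : Affine → Affine
Sₐ x@(affine a t _) = affine (a ∸ proj₁ (stepSplit x)) (3 * t) (proj₂ (stepSplit x))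

-- All halvings are forced by the offset and leave an odd number: then S is affine on the whole family.
Exact : Affine → Set
Exact x@(affine a _ _) = proj₁ (stepSplit x) < a × Odd (proj₂ (stepSplit x))

exact? : ∀ x → Dec (Exact x)
exact? x@(affine a _ _) = (proj₁ (stepSplit x) <? a) ×-dec (proj₂ (stepSplit x) % 2 ≟ 1)

3*⟦⟧+1 : ∀ {a t b e s} q → e ≤ a → 3 * b + 1 ≡ 2 ^ e * s →
         3 * ⟦ affine a t b ⟧ q + 1 ≡ 2 ^ e * ⟦ affine (a ∸ e) (3 * t) s ⟧ q
3*⟦⟧+1 {a} {t} {b} {e} {s} q e≤a 3b+1≡ = begin
  3 * (2 ^ a * t * q + b) + 1                        ≡⟨ cong (λ c → 3 * (c * t * q + b) + 1) 2^a≡ ⟩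
  3 * (2 ^ e * 2 ^ (a ∸ e) * t * q + b) + 1          ≡⟨ regroup (2 ^ e) (2 ^ (a ∸ e)) t q b ⟩
  2 ^ e * (2 ^ (a ∸ e) * (3 * t) * q) + (3 * b + 1)  ≡⟨ cong (_+_ (2 ^ e * (2 ^ (a ∸ e) * (3 * t) * q))) 3b+1≡ ⟩
  2 ^ e * (2 ^ (a ∸ e) * (3 * t) * q) + 2 ^ e * s    ≡⟨ sym (*-distribˡ-+ (2 ^ e) _ s) ⟩
  2 ^ e * (2 ^ (a ∸ e) * (3 * t) * q + s)            ∎
  where
    open ≡-Reasoning
    2^a≡ : 2 ^ a ≡ 2 ^ e * 2 ^ (a ∸ e)
    2^a≡ = trans (cong (2 ^_) (sym (m+[n∸m]≡n e≤a))) (^-distribˡ-+-* 2 e (a ∸ e))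
    regroup : ∀ x y t q b → 3 * (x * y * t * q + b) + 1 ≡ x * (y * (3 * t) * q) + (3 * b + 1)
    regroup = solve-∀

⟦⟧-odd : ∀ {a t b} q → 0 < a → Odd b → Odd (⟦ affine a t b ⟧ q)
⟦⟧-odd {suc a} {t} {b} q _ b-odd =
  subst (λ c → Odd (c + b)) (sym (trans (cong (_* q) (*-assoc 2 (2 ^ a) t)) (*-assoc 2 (2 ^ a * t) q)))
        (2*m+n-odd (2 ^ a * t * q) b-odd)

S-⟦⟧-≤ : ∀ x q → S (⟦ x ⟧ q) ≤ ⟦ Sₐ x ⟧ q
S-⟦⟧-≤ x@(affine a t b) q = begin
  oddPart (3 * ⟦ x ⟧ q + 1)         ≡⟨ cong oddPart (3*⟦⟧+1 q (splitTwos-≤ a n) (splitTwos-≡ a n)) ⟩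
  oddPart (2 ^ e * ⟦ Sₐ x ⟧ q)      ≤⟨ oddPart-2^*-≤ e (⟦ Sₐ x ⟧ q) ⟩
  ⟦ Sₐ x ⟧ q                        ∎
  where
    open ≤-Reasoning
    n = 3 * b + 1
    e = proj₁ (stepSplit x)

S-⟦⟧ : ∀ x q → Exact x → S (⟦ x ⟧ q) ≡ ⟦ Sₐ x ⟧ q
S-⟦⟧ x@(affine a t b) q (e<a , s-odd) = begin
  oddPart (3 * ⟦ x ⟧ q + 1)         ≡⟨ cong oddPart (3*⟦⟧+1 q (<⇒≤ e<a) (splitTwos-≡ a n)) ⟩
  oddPart (2 ^ e * ⟦ Sₐ x ⟧ q)      ≡⟨ oddPart-2^*-odd e (⟦⟧-odd q (m<n⇒0<n∸m e<a) s-odd) ⟩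
  ⟦ Sₐ x ⟧ q                        ∎
  where
    open ≡-Reasoning
    n = 3 * b + 1
    e = proj₁ (stepSplit x)

iterₐ : ℕ → Affine → Affine
iterₐ zero x = x
iterₐ (suc n) x = Sₐ (iterₐ n x)

ExactUpTo : ℕ → Affine → Set
ExactUpTo n x = ∀ {i} → i < n → Exact (iterₐ i x)

iter-⟦⟧ : ∀ n x q → ExactUpTo n x → iter n (⟦ x ⟧ q) ≡ ⟦ iterₐ n x ⟧ q
iter-⟦⟧ zero x q _ = refl
iter-⟦⟧ (suc n) x q exact =
  trans (cong S (iter-⟦⟧ n x q (exact ∘ m≤n⇒m≤1+n))) (S-⟦⟧ (iterₐ n x) q (exact ≤-refl))

iter-⟦⟧-≤ : ∀ n x q → ExactUpTo n x → iter (suc n) (⟦ x ⟧ q) ≤ ⟦ iterₐ (suc n) x ⟧ q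
iter-⟦⟧-≤ n x q exact = subst (λ m → S m ≤ ⟦ iterₐ (suc n) x ⟧ q) (sym (iter-⟦⟧ n x q exact)) (S-⟦⟧-≤ (iterₐ n x) q)

_≼_ : Affine → Affine → Set
x ≼ y = coefficient x ≤ coefficient y × offset x ≤ offset y

_≺_ : Affine → Affine → Set
x ≺ y = coefficient x ≤ coefficient y × offset x < offset y

_≼?_ : ∀ x y → Dec (x ≼ y)
x ≼? y = (coefficient x ≤? coefficient y) ×-dec (offset x ≤? offset y)

_≺?_ : ∀ x y → Dec (x ≺ y)
x ≺? y = (coefficient x ≤? coefficient y) ×-dec (offset x <? offset y)

⟦⟧-mono-≤ : ∀ {x y} q → x ≼ y → ⟦ x ⟧ q ≤ ⟦ y ⟧ q
⟦⟧-mono-≤ q (c≤c′ , b≤b′) = +-mono-≤ (*-monoˡ-≤ q c≤c′) b≤b′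

⟦⟧-mono-< : ∀ {x y} q → x ≺ y → ⟦ x ⟧ q < ⟦ y ⟧ q
⟦⟧-mono-< q (c≤c′ , b<b′) = +-mono-≤-< (*-monoˡ-≤ q c≤c′) b<b′

-- FirstDrop h m j: D(m) = j + 1 if j < h, and D(m) > h if j = h.
FirstDrop : ℕ → ℕ → ℕ → Set
FirstDrop h m j = (∀ {i} → i < j → m ≤ iter (suc i) m) × (j < h → iter (suc j) m < m)

dropWithin⇔ : ∀ {h m j k} → FirstDrop h m j → k ≤ h → DropWithin k m ⇔ j < k
dropWithin⇔ {h} {m} {j} {k} (stays , drops) k≤h = mk⇔ to from
  where
    to : DropWithin k m → j < k
    to (i , drop) = ≰⇒> λ k≤j → <⇒≱ drop (stays (<-≤-trans (toℕ<n i) k≤j))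
    from : j < k → DropWithin k m
    from j<k = fromℕ< j<k , subst (λ i → iter (suc i) m < m) (sym (toℕ-fromℕ< j<k)) (drops (≤-trans j<k k≤h))

FirstDropₐ : ℕ → Affine → ℕ → Set
FirstDropₐ h x j = ExactUpTo j x × (∀ {i} → i < j → x ≼ iterₐ (suc i) x) × (j < h → iterₐ (suc j) x ≺ x)

firstDropₐ? : ∀ h x j → Dec (FirstDropₐ h x j)
firstDropₐ? h x j =
  allUpTo? (λ i → exact? (iterₐ i x)) j ×-dec
  allUpTo? (λ i → x ≼? iterₐ (suc i) x) j ×-dec
  (j <? h →-dec iterₐ (suc j) x ≺? x)

FirstDropₐ⇒FirstDrop : ∀ {h x j} → FirstDropₐ h x j → ∀ q → FirstDrop h (⟦ x ⟧ q) j
FirstDropₐ⇒FirstDrop {h} {x} {j} (exact , stays , drops) q = stay , drop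
  where
    stay : ∀ {i} → i < j → ⟦ x ⟧ q ≤ iter (suc i) (⟦ x ⟧ q)
    stay {i} i<j = ≤-trans (⟦⟧-mono-≤ {x} {iterₐ (suc i) x} q (stays i<j))
                           (≤-reflexive (sym (iter-⟦⟧ (suc i) x q (λ i′<1+i → exact (≤-trans i′<1+i i<j)))))
    drop : j < h → iter (suc j) (⟦ x ⟧ q) < ⟦ x ⟧ q
    drop j<h = ≤-<-trans (iter-⟦⟧-≤ j x q exact) (⟦⟧-mono-< {iterₐ (suc j) x} {x} q (drops j<h))

-- Drop times modulo 32

-- Residues are represented by 2 ≤ r < 34, so that every m ≥ 2 is 32 q + r; with r = 1 the
-- bound 24 q + 1 on S(32 q + 1) is not below 32 q + 1 at q = 0.
firstDropₐ-residues : ∀ {r} → r < 34 → 2 ≤ r → Odd r → ∃[ j ] j < 4 × FirstDropₐ 3 (affine 5 1 r) j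
firstDropₐ-residues = toWitness {a? = allUpTo? (λ r → 2 ≤? r →-dec (r % 2 ≟ 1 →-dec anyUpTo? (firstDropₐ? 3 (affine 5 1 r)) 4)) 34} _

m≡32*q+r : ∀ {m} → 2 ≤ m → ∃[ q ] ∃[ r ] r < 34 × 2 ≤ r × m ≡ 32 * q + r
m≡32*q+r {m} 2≤m = (m ∸ 2) ℕ./ 32 , 2 + (m ∸ 2) % 32 , s≤s (s≤s (m%n<n (m ∸ 2) 32)) , s≤s (s≤s z≤n) , m≡
  where
    regroup : ∀ r q → 2 + (r + q * 32) ≡ 32 * q + (2 + r)
    regroup = solve-∀
    m≡ : m ≡ 32 * ((m ∸ 2) ℕ./ 32) + (2 + (m ∸ 2) % 32)
    m≡ = begin
      m                                           ≡⟨ sym (m+[n∸m]≡n 2≤m) ⟩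
      2 + (m ∸ 2)                                 ≡⟨ cong (_+_ 2) (m≡m%n+[m/n]*n (m ∸ 2) 32) ⟩
      2 + ((m ∸ 2) % 32 + (m ∸ 2) ℕ./ 32 * 32)    ≡⟨ regroup ((m ∸ 2) % 32) ((m ∸ 2) ℕ./ 32) ⟩
      32 * ((m ∸ 2) ℕ./ 32) + (2 + (m ∸ 2) % 32)  ∎
      where open ≡-Reasoning

[32*q+r]%2≡r%2 : ∀ q r → (32 * q + r) % 2 ≡ r % 2
[32*q+r]%2≡r%2 q r = trans (cong (_% 2) (regroup q r)) ([m+kn]%n≡m%n r (16 * q) 2)
  where
    regroup : ∀ q r → 32 * q + r ≡ r + 16 * q * 2
    regroup = solve-∀

dropWithin-32*q+r : ∀ {k r} → k ≤ 3 → r < 34 → 2 ≤ r → Odd r → ∃[ j ] ∀ q → DropWithin k (32 * q + r) ⇔ j < k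
dropWithin-32*q+r k≤3 r<34 2≤r r-odd =
  let j , _ , first = firstDropₐ-residues r<34 2≤r r-odd
  in  j , λ q → dropWithin⇔ (FirstDropₐ⇒FirstDrop first q) k≤3

dropWithin-periodic : ∀ {k m} → k ≤ 3 → 2 ≤ m → Odd m → DropWithin k (32 + m) ⇔ DropWithin k m
dropWithin-periodic {k} {m} k≤3 2≤m m-odd = periodic (m≡32*q+r 2≤m)
  where
    periodic : ∃[ q ] ∃[ r ] r < 34 × 2 ≤ r × m ≡ 32 * q + r → DropWithin k (32 + m) ⇔ DropWithin k m
    periodic (q , r , r<34 , 2≤r , m≡) =
      subst (λ n → DropWithin k (32 + n) ⇔ DropWithin k n) (sym m≡)
            (⇔-sym (drop⇔ q) ⇔-∘ subst (_⇔ j < k) shift (drop⇔ (suc q)))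
      where
        classified = dropWithin-32*q+r k≤3 r<34 2≤r (trans (sym ([32*q+r]%2≡r%2 q r)) (subst Odd m≡ m-odd))
        j = proj₁ classified
        drop⇔ = proj₂ classified
        shift : DropWithin k (32 * suc q + r) ≡ DropWithin k (32 + (32 * q + r))
        shift = cong (DropWithin k) (trans (cong (_+ r) (*-suc 32 q)) (+-assoc 32 (32 * q) r))

counted-periodic : ∀ {k m} → k ≤ 3 → 2 ≤ m → Counted k (32 + m) ⇔ Counted k m
counted-periodic {k} {m} k≤3 2≤m = mk⇔ to from
  where
    32+m%2 : (32 + m) % 2 ≡ m % 2
    32+m%2 = [32*q+r]%2≡r%2 1 m
    to : Counted k (32 + m) → Counted k m
    to (odd , _ , drop) = let m-odd = trans (sym 32+m%2) odd in
      m-odd , 2≤m , Equivalence.to (dropWithin-periodic k≤3 2≤m m-odd) drop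
    from : Counted k m → Counted k (32 + m)
    from (m-odd , _ , drop) =
      trans 32+m%2 m-odd , s≤s (s≤s z≤n) , Equivalence.from (dropWithin-periodic k≤3 2≤m m-odd) drop

-- Counting and limits

module _ {ℓ} {P : Pred ℕ ℓ} (P? : Decidable P) where

  countUpTo : ℕ → ℕ
  countUpTo n = length (filter P? (upTo n))

  countUpTo-suc : ∀ n → countUpTo (suc n) ≡ countUpTo n + length (filter P? [ n ])
  countUpTo-suc n = begin
    length (filter P? (upTo (suc n)))              ≡⟨ cong (length ∘ filter P?) (sym (upTo-∷ʳ n)) ⟩
    length (filter P? (upTo n ++ [ n ]))           ≡⟨ cong length (filter-++ P? (upTo n) [ n ]) ⟩
    length (filter P? (upTo n) ++ filter P? [ n ]) ≡⟨ length-++ (filter P? (upTo n)) ⟩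
    countUpTo n + length (filter P? [ n ])         ∎
    where open ≡-Reasoning

  length-filter-[]-cong : ∀ {a b} → does (P? a) ≡ does (P? b) → length (filter P? [ a ]) ≡ length (filter P? [ b ])
  length-filter-[]-cong {a} {b} eq with does (P? a) | does (P? b)
  ... | false | false = refl
  ... | true  | true  = refl
  ... | false | true  with () ← eq
  ... | true  | false with () ← eq

  countUpTo-periodic : ∀ {p s c} → (∀ {m} → s ≤ m → does (P? (p + m)) ≡ does (P? m)) →
                       countUpTo (p + s) ≡ countUpTo s + c → ∀ d → countUpTo (p + (s + d)) ≡ countUpTo (s + d) + c
  countUpTo-periodic {p} {s} {c} periodic base zero =
    subst (λ n → countUpTo (p + n) ≡ countUpTo n + c) (sym (+-identityʳ s)) base
  countUpTo-periodic {p} {s} {c} periodic base (suc d) = begin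
    countUpTo (p + (s + suc d))                          ≡⟨ cong countUpTo (trans (cong (_+_ p) (+-suc s d)) (+-suc p (s + d))) ⟩
    countUpTo (suc (p + (s + d)))                        ≡⟨ countUpTo-suc (p + (s + d)) ⟩
    countUpTo (p + (s + d)) + length (filter P? [ p + (s + d) ])
      ≡⟨ cong₂ _+_ (countUpTo-periodic periodic base d) (length-filter-[]-cong (periodic (m≤m+n s d))) ⟩
    countUpTo (s + d) + c + length (filter P? [ s + d ]) ≡⟨ xy∙z≈xz∙y (countUpTo (s + d)) c _ ⟩
    countUpTo (s + d) + length (filter P? [ s + d ]) + c ≡⟨ cong (_+ c) (sym (countUpTo-suc (s + d))) ⟩
    countUpTo (suc (s + d)) + c                          ≡⟨ cong (λ n → countUpTo n + c) (sym (+-suc s d)) ⟩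
    countUpTo (s + suc d) + c                            ∎
    where open ≡-Reasoning

N-periodic : ∀ {k c} → k ≤ 3 → N k 33 ≡ N k 1 + c → ∀ y → N k (32 + suc y) ≡ N k (suc y) + c
N-periodic {k} k≤3 base = countUpTo-periodic (counted? k) {p = 32} {s = 2} (λ 2≤m → does-⇔ (counted-periodic k≤3 2≤m) (counted? k _) (counted? k _)) base

N-≤ : ∀ k x → N k x ≤ suc x
N-≤ k x = ≤-trans (length-filter (counted? k) (upTo (suc x))) (≤-reflexive (length-upTo (suc x)))

periodic-increments : ∀ (G : ℕ → ℕ) {p c} → (∀ y → G (p + y) ≡ G y + c) → ∀ q r → G (r + q * p) ≡ G r + q * c
periodic-increments G period zero r = trans (cong G (+-identityʳ r)) (sym (+-identityʳ (G r)))
periodic-increments G {p} {c} period (suc q) r = begin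
  G (r + (p + q * p))  ≡⟨ cong G (x∙yz≈y∙xz r p (q * p)) ⟩
  G (p + (r + q * p))  ≡⟨ period (r + q * p) ⟩
  G (r + q * p) + c    ≡⟨ cong (_+ c) (periodic-increments G period q r) ⟩
  G r + q * c + c      ≡⟨ trans (+-assoc (G r) (q * c) c) (cong (_+_ (G r)) (+-comm (q * c) c)) ⟩
  G r + suc q * c      ∎
  where open ≡-Reasoning

periodic-sandwich : ∀ (G : ℕ → ℕ) {p c B} .{{_ : NonZero p}} → (∀ y → G (p + y) ≡ G y + c) → (∀ {r} → r < p → G r ≤ B) →
                    ∀ y → p * G y ≤ c * suc y + (p * B + c * p) × c * suc y ≤ p * G y + (p * B + c * p)
periodic-sandwich G {p} {c} {B} period G≤B y = upper , lower
  where
    open ≤-Reasoning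
    r = y % p
    q = y ℕ./ p
    y≡ : y ≡ r + q * p
    y≡ = m≡m%n+[m/n]*n y p
    Gy≡ : G y ≡ G r + q * c
    Gy≡ = trans (cong G y≡) (periodic-increments G period q r)
    swap : ∀ p q c → p * (q * c) ≡ c * (q * p)
    swap = solve-∀
    upper : p * G y ≤ c * suc y + (p * B + c * p)
    upper = begin
      p * G y                      ≡⟨ trans (cong (p *_) Gy≡) (*-distribˡ-+ p (G r) (q * c)) ⟩
      p * G r + p * (q * c)        ≤⟨ +-mono-≤ (*-monoʳ-≤ p (G≤B (m%n<n y p))) (≤-reflexive (swap p q c)) ⟩
      p * B + c * (q * p)          ≤⟨ +-monoʳ-≤ (p * B) (*-monoʳ-≤ c (≤-trans (m≤n+m (q * p) r) (≤-trans (≤-reflexive (sym y≡)) (n≤1+n y)))) ⟩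
      p * B + c * suc y            ≤⟨ ≤-trans (≤-reflexive (+-comm (p * B) (c * suc y))) (+-monoʳ-≤ (c * suc y) (m≤m+n (p * B) (c * p))) ⟩
      c * suc y + (p * B + c * p)  ∎
    lower : c * suc y ≤ p * G y + (p * B + c * p)
    lower = begin
      c * suc y                    ≤⟨ *-monoʳ-≤ c (≤-trans (≤-reflexive (cong suc y≡)) (+-monoˡ-≤ (q * p) (m%n<n y p))) ⟩
      c * (p + q * p)              ≡⟨ trans (*-distribˡ-+ c p (q * p)) (cong (_+_ (c * p)) (sym (swap p q c))) ⟩
      c * p + p * (q * c)          ≤⟨ +-monoʳ-≤ (c * p) (*-monoʳ-≤ p (≤-trans (m≤n+m (q * c) (G r)) (≤-reflexive (sym Gy≡)))) ⟩
      c * p + p * G y              ≤⟨ ≤-trans (≤-reflexive (+-comm (c * p) (p * G y))) (+-monoʳ-≤ (p * G y) (m≤n+m (c * p) (p * B))) ⟩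
      p * G y + (p * B + c * p)    ∎

∣m⊖n∣≤ : ∀ {m n K} → m ≤ n + K → n ≤ m + K → ℤ.∣ m ℤ.⊖ n ∣ ≤ K
∣m⊖n∣≤ {m} {n} m≤n+K n≤m+K with ≤-total n m
... | inj₁ n≤m rewrite ℤ.⊖-≥ n≤m = m≤n+o⇒m∸n≤o m n m≤n+K
... | inj₂ m≤n rewrite ℤ.⊖-≤ m≤n | ℤ.∣-i∣≡∣i∣ (+ (n ∸ m)) = m≤n+o⇒m∸n≤o n m n≤m+K

∣m/x-n/y∣<ε : ∀ {m n x y K} .{{_ : NonZero x}} .{{_ : NonZero y}} → m * y ≤ n * x + K → n * x ≤ m * y + K →
              ∀ ε → ℚ.0ℚ ℚ.< ε → K * ℚ.↧ₙ ε < x → ℚ.∣ (+ m) / x ℚ.- (+ n) / y ∣ ℚ.< ε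
∣m/x-n/y∣<ε {m} {n} {x@(suc x-1)} {y@(suc y-1)} {K} my≤nx+K nx≤my+K ε@(ℚ.mkℚ ℤ.+[1+ a ] b _) _ K*↧ε<x =
  toℚᵘ-cancel-< (ℚᵘ.<-respˡ-≃ (ℚᵘ.≃-sym unnormalise) distance<ε)
  where
    m/x n/y : ℚ.ℚ
    m/x = (+ m) / x
    n/y = (+ n) / y
    unnormalise : ℚ.toℚᵘ ℚ.∣ m/x ℚ.- n/y ∣ ℚᵘ.≃ ℚᵘ.∣ ℚᵘ.mkℚᵘ (+ m) x-1 ℚᵘ.- ℚᵘ.mkℚᵘ (+ n) y-1 ∣
    unnormalise = ℚᵘ.≃-trans (toℚᵘ-homo-∣-∣ (m/x ℚ.- n/y)) (ℚᵘ.∣-∣-cong (ℚᵘ.≃-trans (toℚᵘ-homo-+ m/x (ℚ.- n/y))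
                    (ℚᵘ.+-cong (toℚᵘ-fromℚᵘ (ℚᵘ.mkℚᵘ (+ m) x-1))
                               (ℚᵘ.≃-trans (toℚᵘ-homo‿- n/y) (ℚᵘ.-‿cong (toℚᵘ-fromℚᵘ (ℚᵘ.mkℚᵘ (+ n) y-1)))))))
    numerator : + m ℤ.* + y ℤ.+ ℤ.- (+ n) ℤ.* + x ≡ (m * y) ℤ.⊖ (n * x)
    numerator = trans (cong₂ ℤ._+_ (sym (ℤ.pos-* m y)) (trans (sym (ℤ.neg-distribˡ-* (+ n) (+ x))) (cong ℤ.-_ (sym (ℤ.pos-* n x)))))
                      (ℤ.m-n≡m⊖n (m * y) (n * x))
    bound : ℤ.∣ (m * y) ℤ.⊖ (n * x) ∣ * suc b < suc a * (x * y)
    bound = <-≤-trans (≤-<-trans (*-monoˡ-≤ (suc b) (∣m⊖n∣≤ my≤nx+K nx≤my+K)) K*↧ε<x)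
                      (≤-trans (m≤m*n x y) (m≤n*m (x * y) (suc a)))
    distance<ε : ℚᵘ.∣ ℚᵘ.mkℚᵘ (+ m) x-1 ℚᵘ.- ℚᵘ.mkℚᵘ (+ n) y-1 ∣ ℚᵘ.< ℚ.toℚᵘ ε
    distance<ε = ℚᵘ.*<* (subst (λ z → + ℤ.∣ z ∣ ℤ.* + suc b ℤ.< ℤ.+[1+ a ] ℤ.* + (x * y)) (sym numerator)
                         (subst₂ ℤ._<_ (ℤ.pos-* ℤ.∣ (m * y) ℤ.⊖ (n * x) ∣ (suc b)) (ℤ.pos-* (suc a) (x * y)) (ℤ.+<+ bound)))
∣m/x-n/y∣<ε _ _ ε@(ℚ.mkℚ (+ 0) _ _) 0<ε _ with () ← ℚ.positive {ε} 0<ε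
∣m/x-n/y∣<ε _ _ ε@(ℚ.mkℚ ℤ.-[1+ _ ] _ _) 0<ε _ with () ← ℚ.positive {ε} 0<ε

ratio-tendsto : ∀ k c → k ≤ 3 → N k 33 ≡ N k 1 + c → Tendsto (ratio k) ((+ (2 * c)) / 32)
ratio-tendsto k c k≤3 base ε 0<ε = suc (K * ℚ.↧ₙ ε) , close
  where
    G : ℕ → ℕ
    G y = 2 * N k (suc y)
    G-period : ∀ y → G (32 + y) ≡ G y + 2 * c
    G-period y = trans (cong (2 *_) (N-periodic k≤3 base y)) (*-distribˡ-+ 2 (N k (suc y)) c)
    G≤ : ∀ {r} → r < 32 → G r ≤ 2 * 33
    G≤ {r} r<32 = *-monoʳ-≤ 2 (≤-trans (N-≤ k (suc r)) (s≤s r<32))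
    K : ℕ
    K = 32 * (2 * 33) + 2 * c * 32
    close : ∀ x → suc (K * ℚ.↧ₙ ε) ≤ x → ℚ.∣ ratio k x ℚ.- (+ (2 * c)) / 32 ∣ ℚ.< ε
    close (suc n) (s≤s K*↧ε≤n) = ∣m/x-n/y∣<ε {G n} {2 * c} {suc n} {32} {K} upper lower ε 0<ε (s≤s K*↧ε≤n)
      where
        sandwich = periodic-sandwich G G-period G≤ n
        upper : G n * 32 ≤ 2 * c * suc n + K
        upper = ≤-trans (≤-reflexive (*-comm (G n) 32)) (proj₁ sandwich)
        lower : 2 * c * suc n ≤ G n * 32 + K
        lower = ≤-trans (proj₂ sandwich) (≤-reflexive (cong (_+ K) (*-comm 32 (G n))))

-- The increment of N k over a period, 8, 10 or 12, is found by evaluating N k 33 and N k 1.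
mainTheorem15 : Tendsto (ratio 1) (+ 1 / 2) × (Tendsto (ratio 2) (+ 5 / 8) × Tendsto (ratio 3) (+ 3 / 4))
mainTheorem15 = ratio-tendsto 1 8 (s≤s z≤n) refl , ratio-tendsto 2 10 (s≤s (s≤s z≤n)) refl ,
                ratio-tendsto 3 12 (s≤s (s≤s (s≤s z≤n))) refl
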